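{- For any starting configuration $S$ (a multiset of $n\ge 2$ positive integers) and any integer $k\ge 0$, if Alice plays the greedy strategy (in each move, choose two sheets carrying the two smallest numbers), then the sum of the numbers after $k$ moves equals $opt(S,k)$.
   Context: One-player game: Alice has $n\ge2$ sheets of paper, each with a positive integer written on it. A move consists of choosing two sheets, with numbers $a$ and $b$, erasing them and writing $a+b$ on both sheets; this move is denoted $(a,b)$. The configuration is the multiset of the $n$ numbers on the sheets; the starting configuration is the initial multiset. $opt(S,k)$ denotes the smallest possible sum of the numbers on the sheets that Alice can achieve after performing exactly $k$ moves starting from configuration $S$. -}

module Defs where

open import Data.Nat using (ℕ; zero; suc; _+_; _≤_; _<_)
open import Data.Fin using (Fin)
open import Data.Vec using (Vec; lookup; _[_]≔_; sum)
open import Data.Product using (Σ; _×_; ∃)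
open import Relation.Binary.PropositionalEquality using (_≡_; _≢_)

-- A configuration of n sheets: the number written on each sheet
-- (sheets are labelled by Fin n; the multiset is the multiset of entries).
Config : ℕ → Set
Config n = Vec ℕ n

Positive : ∀ {n} → Config n → Set
Positive {n} v = (l : Fin n) → 0 < lookup v l

move : ∀ {n} → Config n → Fin n → Fin n → Config n
move v i j = let s = lookup v i + lookup v j in (v [ i ]≔ s) [ j ]≔ s

data Reachable {n : ℕ} : ℕ → Config n → Config n → Set where
  done : ∀ {v} → Reachable zero v v
  step : ∀ {k v w} (i j : Fin n) → i ≢ j →
         Reachable k (move v i j) w → Reachable (suc k) v w

TwoSmallest : ∀ {n} → Config n → Fin n → Fin n → Set
TwoSmallest {n} v i j =
  i ≢ j × ((l : Fin n) → l ≢ i → l ≢ j →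
            (lookup v i ≤ lookup v l) × (lookup v j ≤ lookup v l))

data GreedyPlay {n : ℕ} : ℕ → Config n → Config n → Set where
  done : ∀ {v} → GreedyPlay zero v v
  step : ∀ {k v w} (i j : Fin n) → TwoSmallest v i j →
         GreedyPlay k (move v i j) w → GreedyPlay (suc k) v w

IsOpt : ∀ {n} → Config n → ℕ → ℕ → Set
IsOpt {n} S k m =
  (∃ λ (w : Config n) → Reachable k S w × sum w ≡ m) ×
  (∀ (w : Config n) → Reachable k S w → m ≤ sum w)

-- Each move (a, b) adds a + b to the total, so after a fixed sequence of moves the final sum is
-- a linear function of the starting numbers, whose coefficients (weights) depend only on the
-- sequence. The proof is an exchange argument by induction on k: a play whose first move is
-- not greedy can be matched by one whose first move is greedy. If the two first moves use
-- disjoint sheets, they commute, and by induction the rest of the play may be assumed greedy.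
-- If they share a sheet, the configurations after two moves are compared entrywise or by "transfers":
-- replacing two entries by two others with the same total, the smaller of which is at most
-- both old entries, never hurts, because by linearity one can arrange (relabelling the later
-- moves if necessary) that the smaller new entry sits on the sheet of larger weight.
module Submission where

open import Defs

open import Data.Fin using (Fin; zero; suc; _≟_; punchIn; punchOut)
open import Data.Fin.Properties using (punchInᵢ≢i; punchIn-punchOut; punchIn-injective)
open import Data.Fin.Permutation as Perm using (Permutation′; _⟨$⟩ʳ_; _⟨$⟩ˡ_; inverseˡ)
import Data.Fin.Permutation.Components as PC
open import Data.Nat using (ℕ; zero; suc; _+_; _*_; _≤_; _≤?_; z≤n; s≤s)
open import Data.Nat.Properties hiding (_≟_)
open import Algebra.Properties.CommutativeMonoid.Sum +-0-commutativeMonoid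
  using (sum-cong-≗; sum-remove; sum-permute) renaming (sum to ∑)
open import Data.Nat.Tactic.RingSolver using (solve-∀)
open import Data.Product using (Σ; ∃; _×_; _,_; proj₁; proj₂) renaming (swap to swap×)
open import Data.Sum using (_⊎_; inj₁; inj₂; swap) renaming (map to map⊎)
open import Data.Vec using ([]; _∷_; lookup; _[_]≔_; sum; tabulate)
open import Data.Vec.Properties using (lookup∘update; lookup∘update′; tabulate∘lookup; tabulate-cong)
open import Data.Vec.Functional using (Vector; removeAt; updateAt)
open import Data.Vec.Functional.Properties using (updateAt-updates; updateAt-minimal)
open import Function using (_∘_; Injective; Injection)
open import Function.Properties.Inverse using (↔⇒↣)
open import Relation.Nullary using (yes; no; contradiction)
open import Relation.Binary.PropositionalEquality

private
  variable
    n k : ℕ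

∑-mono-≤ : {f g : Vector ℕ n} → (∀ l → f l ≤ g l) → ∑ f ≤ ∑ g
∑-mono-≤ {zero}  f≤g = ≤-refl
∑-mono-≤ {suc n} f≤g = +-mono-≤ (f≤g zero) (∑-mono-≤ (f≤g ∘ suc))

∑-remove₂ : (f : Vector ℕ (suc (suc n))) {p q : Fin (suc (suc n))} (p≢q : p ≢ q) →
            ∑ f ≡ f p + (f q + ∑ (removeAt (removeAt f p) (punchOut p≢q)))
∑-remove₂ {n} f {p} {q} p≢q = begin
  ∑ f                                              ≡⟨ sum-remove f ⟩
  f p + ∑ (removeAt f p)                           ≡⟨ cong (f p +_) (sum-remove (removeAt f p)) ⟩
  f p + (f (punchIn p (punchOut p≢q)) + ∑ rest)    ≡⟨ cong (λ r → f p + (f r + ∑ rest)) (punchIn-punchOut p≢q) ⟩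
  f p + (f q + ∑ rest)                             ∎
  where
    open ≡-Reasoning
    rest : Vector ℕ n
    rest = removeAt (removeAt f p) (punchOut p≢q)

∑-agree-outside : {f g : Vector ℕ n} {p q : Fin n} → p ≢ q →
                  (∀ l → l ≢ p → l ≢ q → g l ≡ f l) →
                  ∑ g + (f p + f q) ≡ ∑ f + (g p + g q)
∑-agree-outside {zero} {p = ()}
∑-agree-outside {suc zero} {p = zero} {zero} p≢q _ = contradiction refl p≢q
∑-agree-outside {suc (suc n)} {f} {g} {p} {q} p≢q agree = begin
  ∑ g + (f p + f q)                     ≡⟨ cong (_+ (f p + f q)) (∑-remove₂ g p≢q) ⟩
  g p + (g q + ∑ (rest g)) + (f p + f q) ≡⟨ cong (λ r → g p + (g q + r) + (f p + f q)) (sum-cong-≗ rest-agree) ⟩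
  g p + (g q + ∑ (rest f)) + (f p + f q) ≡⟨ shuffle (g p) (g q) (f p) (f q) (∑ (rest f)) ⟩
  f p + (f q + ∑ (rest f)) + (g p + g q) ≡⟨ cong (_+ (g p + g q)) (∑-remove₂ f p≢q) ⟨
  ∑ f + (g p + g q)                     ∎
  where
    open ≡-Reasoning
    rest : Vector ℕ (suc (suc n)) → Vector ℕ n
    rest h = removeAt (removeAt h p) (punchOut p≢q)
    rest-agree : ∀ l → rest g l ≡ rest f l
    rest-agree l = agree _ (punchInᵢ≢i p _) λ eq →
      punchInᵢ≢i (punchOut p≢q) l
        (punchIn-injective p _ _ (trans eq (sym (punchIn-punchOut p≢q))))
    shuffle : ∀ a b c d r → a + (b + r) + (c + d) ≡ c + (d + r) + (a + b)
    shuffle = solve-∀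

move′ : Vector ℕ n → Fin n → Fin n → Vector ℕ n
move′ x i j l with l ≟ i | l ≟ j
... | yes _ | _     = x i + x j
... | no _  | yes _ = x i + x j
... | no _  | no _  = x l

locate : (i j l : Fin n) → (l ≡ i ⊎ l ≡ j) ⊎ (l ≢ i × l ≢ j)
locate i j l with l ≟ i | l ≟ j
... | yes l≡i | _       = inj₁ (inj₁ l≡i)
... | no _    | yes l≡j = inj₁ (inj₂ l≡j)
... | no l≢i  | no l≢j  = inj₂ (l≢i , l≢j)

move′-≡ : (x : Vector ℕ n) {i j l : Fin n} → l ≡ i ⊎ l ≡ j → move′ x i j l ≡ x i + x j
move′-≡ x {i} {j} {l} l∈ij with l ≟ i | l ≟ j | l∈ij
... | yes _  | _      | _        = refl
... | no _   | yes _  | _        = refl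
... | no l≢i | no _   | inj₁ l≡i = contradiction l≡i l≢i
... | no _   | no l≢j | inj₂ l≡j = contradiction l≡j l≢j

move′-≢ : (x : Vector ℕ n) {i j l : Fin n} → l ≢ i → l ≢ j → move′ x i j l ≡ x l
move′-≢ x {i} {j} {l} l≢i l≢j with l ≟ i | l ≟ j
... | yes l≡i | _       = contradiction l≡i l≢i
... | no _    | yes l≡j = contradiction l≡j l≢j
... | no _    | no _    = refl

∈-pair-≢ : {a b e l : Fin n} → e ≢ a → e ≢ b → l ≡ a ⊎ l ≡ b → l ≢ e
∈-pair-≢ e≢a _   (inj₁ refl) refl = e≢a refl
∈-pair-≢ _   e≢b (inj₂ refl) refl = e≢b refl

move′-inflationary : (x : Vector ℕ n) (i j l : Fin n) → x l ≤ move′ x i j l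
move′-inflationary x i j l with locate i j l
... | inj₁ (inj₁ refl)   = ≤-trans (m≤m+n (x l) (x j)) (≤-reflexive (sym (move′-≡ x (inj₁ refl))))
... | inj₁ (inj₂ refl)   = ≤-trans (m≤n+m (x l) (x i)) (≤-reflexive (sym (move′-≡ x (inj₂ refl))))
... | inj₂ (l≢i , l≢j)   = ≤-reflexive (sym (move′-≢ x l≢i l≢j))

move′-sym : (x : Vector ℕ n) (i j : Fin n) → move′ x i j ≗ move′ x j i
move′-sym x i j l with locate i j l
... | inj₁ l∈ij        = trans (move′-≡ x l∈ij) (trans (+-comm (x i) (x j)) (sym (move′-≡ x (swap l∈ij))))
... | inj₂ (l≢i , l≢j) = trans (move′-≢ x l≢i l≢j) (sym (move′-≢ x l≢j l≢i))

move′-cong : {x y : Vector ℕ n} (i j : Fin n) → x ≗ y → move′ x i j ≗ move′ y i j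
move′-cong i j x≗y l with locate i j l
... | inj₁ l∈ij        = trans (move′-≡ _ l∈ij) (trans (cong₂ _+_ (x≗y i) (x≗y j)) (sym (move′-≡ _ l∈ij)))
... | inj₂ (l≢i , l≢j) = trans (move′-≢ _ l≢i l≢j) (trans (x≗y l) (sym (move′-≢ _ l≢i l≢j)))

move′-∘ : (x : Vector ℕ n) {τ : Fin n → Fin n} → Injective _≡_ _≡_ τ →
          ∀ i j l → move′ (x ∘ τ) i j l ≡ move′ x (τ i) (τ j) (τ l)
move′-∘ x {τ} τ-inj i j l with locate i j l
... | inj₁ l∈ij        = trans (move′-≡ (x ∘ τ) l∈ij) (sym (move′-≡ x (map⊎ (cong τ) (cong τ) l∈ij)))
... | inj₂ (l≢i , l≢j) = trans (move′-≢ (x ∘ τ) l≢i l≢j) (sym (move′-≢ x (l≢i ∘ τ-inj) (l≢j ∘ τ-inj)))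

∑-move′ : (x : Vector ℕ n) {i j : Fin n} → i ≢ j → ∑ (move′ x i j) ≡ ∑ x + (x i + x j)
∑-move′ x {i} {j} i≢j = +-cancelʳ-≡ (x i + x j) _ _ (begin
  ∑ (move′ x i j) + (x i + x j)          ≡⟨ ∑-agree-outside i≢j (λ _ → move′-≢ x) ⟩
  ∑ x + (move′ x i j i + move′ x i j j)  ≡⟨ cong (∑ x +_) (cong₂ _+_ (move′-≡ x (inj₁ refl))
                                                                    (move′-≡ x (inj₂ refl))) ⟩
  ∑ x + ((x i + x j) + (x i + x j))      ≡⟨ +-assoc (∑ x) _ _ ⟨
  ∑ x + (x i + x j) + (x i + x j)        ∎)
  where open ≡-Reasoning

infix 7 _·_
_·_ : Vector ℕ n → Vector ℕ n → ℕ
c · x = ∑ (λ l → c l * x l)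

·-move′ : (c x : Vector ℕ n) {i j : Fin n} → i ≢ j → c · move′ x i j ≡ move′ c i j · x
·-move′ {n} c x {i} {j} i≢j = +-cancelʳ-≡ (g i + g j) _ _ (begin
  c · move′ x i j + (g i + g j)      ≡⟨ cong (c · move′ x i j +_) ends ⟨
  c · move′ x i j + (f i + f j)      ≡⟨ ∑-agree-outside i≢j agree ⟩
  move′ c i j · x + (g i + g j)      ∎)
  where
    open ≡-Reasoning
    g f : Vector ℕ n
    g l = c l * move′ x i j l
    f l = move′ c i j l * x l
    agree : ∀ l → l ≢ i → l ≢ j → g l ≡ f l
    agree l l≢i l≢j = cong₂ _*_ (sym (move′-≢ c l≢i l≢j)) (move′-≢ x l≢i l≢j)
    distribute : ∀ a b u v → a * (u + v) + b * (u + v) ≡ (a + b) * u + (a + b) * v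
    distribute = solve-∀
    ends : f i + f j ≡ g i + g j
    ends = begin
      f i + f j
        ≡⟨ cong₂ _+_ (cong (_* x i) (move′-≡ c (inj₁ refl))) (cong (_* x j) (move′-≡ c (inj₂ refl))) ⟩
      (c i + c j) * x i + (c i + c j) * x j
        ≡⟨ distribute (c i) (c j) (x i) (x j) ⟨
      c i * (x i + x j) + c j * (x i + x j)
        ≡⟨ cong₂ _+_ (cong (c i *_) (move′-≡ x (inj₁ refl))) (cong (c j *_) (move′-≡ x (inj₂ refl))) ⟨
      g i + g j ∎

module _ (x : Vector ℕ n) {a b c d : Fin n} (c≢a : c ≢ a) (c≢b : c ≢ b) (d≢a : d ≢ a) (d≢b : d ≢ b) where

  move′²-first : ∀ {l} → l ≡ a ⊎ l ≡ b → move′ (move′ x a b) c d l ≡ x a + x b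
  move′²-first l∈ab =
    trans (move′-≢ (move′ x a b) (∈-pair-≢ c≢a c≢b l∈ab) (∈-pair-≢ d≢a d≢b l∈ab)) (move′-≡ x l∈ab)

  move′²-second : ∀ {l} → l ≡ c ⊎ l ≡ d → move′ (move′ x a b) c d l ≡ x c + x d
  move′²-second l∈cd = trans (move′-≡ (move′ x a b) l∈cd) (cong₂ _+_ (move′-≢ x c≢a c≢b) (move′-≢ x d≢a d≢b))

  move′²-outside : ∀ {l} → l ≢ a → l ≢ b → l ≢ c → l ≢ d → move′ (move′ x a b) c d l ≡ x l
  move′²-outside l≢a l≢b l≢c l≢d = trans (move′-≢ (move′ x a b) l≢c l≢d) (move′-≢ x l≢a l≢b)

move′-comm : (x : Vector ℕ n) {a b c d : Fin n} → c ≢ a → c ≢ b → d ≢ a → d ≢ b →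
             move′ (move′ x a b) c d ≗ move′ (move′ x c d) a b
move′-comm x {a} {b} {c} {d} c≢a c≢b d≢a d≢b = pointwise (≢-sym c≢a) (≢-sym d≢a) (≢-sym c≢b) (≢-sym d≢b)
  where
    pointwise : a ≢ c → a ≢ d → b ≢ c → b ≢ d → move′ (move′ x a b) c d ≗ move′ (move′ x c d) a b
    pointwise a≢c a≢d b≢c b≢d l with locate a b l | locate c d l
    ... | inj₁ l∈ab | _ =
      trans (move′²-first x c≢a c≢b d≢a d≢b l∈ab) (sym (move′²-second x a≢c a≢d b≢c b≢d l∈ab))
    ... | inj₂ _ | inj₁ l∈cd =
      trans (move′²-second x c≢a c≢b d≢a d≢b l∈cd) (sym (move′²-first x a≢c a≢d b≢c b≢d l∈cd))
    ... | inj₂ (l≢a , l≢b) | inj₂ (l≢c , l≢d) =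
      trans (move′²-outside x c≢a c≢b d≢a d≢b l≢a l≢b l≢c l≢d)
            (sym (move′²-outside x a≢c a≢d b≢c b≢d l≢c l≢d l≢a l≢b))

move′-reorder-≤ : (x : Vector ℕ n) {a b j : Fin n} → a ≢ b → j ≢ a → j ≢ b → x b ≤ x j →
                  ∀ l → move′ (move′ x a b) j b l ≤ move′ (move′ x a j) b j l
move′-reorder-≤ x {a} {b} {j} a≢b j≢a j≢b xb≤xj l with locate j b l
... | inj₁ l∈jb = ≤-reflexive (begin
  move′ (move′ x a b) j b l      ≡⟨ move′-≡ (move′ x a b) l∈jb ⟩
  move′ x a b j + move′ x a b b  ≡⟨ cong₂ _+_ (move′-≢ x j≢a j≢b) (move′-≡ x (inj₂ refl)) ⟩
  x j + (x a + x b)              ≡⟨ rotate (x a) (x b) (x j) ⟩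
  x b + (x a + x j)              ≡⟨ cong₂ _+_ (move′-≢ x (≢-sym a≢b) (≢-sym j≢b)) (move′-≡ x (inj₂ refl)) ⟨
  move′ x a j b + move′ x a j j  ≡⟨ move′-≡ (move′ x a j) (swap l∈jb) ⟨
  move′ (move′ x a j) b j l      ∎)
  where
    open ≡-Reasoning
    rotate : ∀ u v w → w + (u + v) ≡ v + (u + w)
    rotate = solve-∀
... | inj₂ (l≢j , l≢b) = subst₂ _≤_ (sym (move′-≢ (move′ x a b) l≢j l≢b)) (sym (move′-≢ (move′ x a j) l≢b l≢j))
                           (partner-≤ (locate a b l))
  where
    partner-≤ : (l ≡ a ⊎ l ≡ b) ⊎ (l ≢ a × l ≢ b) → move′ x a b l ≤ move′ x a j l
    partner-≤ (inj₁ (inj₁ refl)) = subst₂ _≤_ (sym (move′-≡ x (inj₁ refl))) (sym (move′-≡ x (inj₁ refl)))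
                                     (+-monoʳ-≤ (x l) xb≤xj)
    partner-≤ (inj₁ (inj₂ l≡b))  = contradiction l≡b l≢b
    partner-≤ (inj₂ (l≢a , _))   = ≤-reflexive (trans (move′-≢ x l≢a l≢b) (sym (move′-≢ x l≢a l≢j)))

-- Plays and their cost

data Play (n : ℕ) : ℕ → Set where
  []   : Play n zero
  step : ∀ {k} (i j : Fin n) → i ≢ j → Play n k → Play n (suc k)

cost : Play n k → Vector ℕ n → ℕ
cost []             x = ∑ x
cost (step i j _ π) x = cost π (move′ x i j)

-- The final sum is linear in the starting numbers: weight π l is the coefficient of x l,
-- obtained by running the moves of π backwards from the all-ones vector.
weight : Play n k → Vector ℕ n
weight []             = λ _ → 1
weight (step i j _ π) = move′ (weight π) i j

cost≡weight· : (π : Play n k) (x : Vector ℕ n) → cost π x ≡ weight π · x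
cost≡weight· []               x = sum-cong-≗ (λ l → sym (*-identityˡ (x l)))
cost≡weight· (step i j i≢j π) x = trans (cost≡weight· π (move′ x i j)) (·-move′ (weight π) x i≢j)

cost-cong : (π : Play n k) {x y : Vector ℕ n} → x ≗ y → cost π x ≡ cost π y
cost-cong π {x} {y} x≗y = begin
  cost π x       ≡⟨ cost≡weight· π x ⟩
  weight π · x   ≡⟨ sum-cong-≗ (λ l → cong (weight π l *_) (x≗y l)) ⟩
  weight π · y   ≡⟨ cost≡weight· π y ⟨
  cost π y       ∎
  where open ≡-Reasoning

cost-mono-≤ : (π : Play n k) {x y : Vector ℕ n} → (∀ l → x l ≤ y l) → cost π x ≤ cost π y
cost-mono-≤ π {x} {y} x≤y = begin
  cost π x       ≡⟨ cost≡weight· π x ⟩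
  weight π · x   ≤⟨ ∑-mono-≤ (λ l → *-monoʳ-≤ (weight π l) (x≤y l)) ⟩
  weight π · y   ≡⟨ cost≡weight· π y ⟨
  cost π y       ∎
  where open ≤-Reasoning

relabel : Permutation′ n → Play n k → Play n k
relabel σ []               = []
relabel σ (step i j i≢j π) =
  step (σ ⟨$⟩ʳ i) (σ ⟨$⟩ʳ j) (i≢j ∘ Injection.injective (↔⇒↣ σ)) (relabel σ π)

weight-relabel : (σ : Permutation′ n) (π : Play n k) → weight (relabel σ π) ≗ weight π ∘ (σ ⟨$⟩ˡ_)
weight-relabel σ []               l = refl
weight-relabel σ (step i j i≢j π) l = begin
  move′ (weight (relabel σ π)) (σ ⟨$⟩ʳ i) (σ ⟨$⟩ʳ j) l
    ≡⟨ move′-cong _ _ (weight-relabel σ π) l ⟩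
  move′ (weight π ∘ (σ ⟨$⟩ˡ_)) (σ ⟨$⟩ʳ i) (σ ⟨$⟩ʳ j) l
    ≡⟨ move′-∘ (weight π) (Injection.injective (↔⇒↣ (Perm.flip σ))) _ _ l ⟩
  move′ (weight π) (σ ⟨$⟩ˡ (σ ⟨$⟩ʳ i)) (σ ⟨$⟩ˡ (σ ⟨$⟩ʳ j)) (σ ⟨$⟩ˡ l)
    ≡⟨ cong₂ (λ i′ j′ → move′ (weight π) i′ j′ (σ ⟨$⟩ˡ l)) (inverseˡ σ) (inverseˡ σ) ⟩
  move′ (weight π) i j (σ ⟨$⟩ˡ l) ∎
  where open ≡-Reasoning

cost-relabel : (σ : Permutation′ n) (π : Play n k) (x : Vector ℕ n) →
               cost (relabel σ π) x ≡ cost π (x ∘ (σ ⟨$⟩ʳ_))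
cost-relabel σ π x = begin
  cost (relabel σ π) x
    ≡⟨ cost≡weight· (relabel σ π) x ⟩
  weight (relabel σ π) · x
    ≡⟨ sum-cong-≗ (λ l → cong (_* x l) (weight-relabel σ π l)) ⟩
  ∑ (λ l → weight π (σ ⟨$⟩ˡ l) * x l)
    ≡⟨ sum-permute _ σ ⟩
  ∑ (λ l → weight π (σ ⟨$⟩ˡ (σ ⟨$⟩ʳ l)) * x (σ ⟨$⟩ʳ l))
    ≡⟨ sum-cong-≗ (λ l → cong (λ l′ → weight π l′ * x (σ ⟨$⟩ʳ l)) (inverseˡ σ)) ⟩
  weight π · (x ∘ (σ ⟨$⟩ʳ_))
    ≡⟨ cost≡weight· π (x ∘ (σ ⟨$⟩ʳ_)) ⟨
  cost π (x ∘ (σ ⟨$⟩ʳ_))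
    ∎
  where open ≡-Reasoning

-- Comparing starting vectors

infix 4 _≼_
_≼_ : Vector ℕ n → Vector ℕ n → Set
_≼_ {n} x y = ∀ {k} (π : Play n k) → Σ (Play n k) λ π′ → cost π′ x ≤ cost π y

≼-trans : {x y z : Vector ℕ n} → x ≼ y → y ≼ z → x ≼ z
≼-trans x≼y y≼z π with y≼z π
... | π′ , y≤z with x≼y π′
...   | π″ , x≤y = π″ , ≤-trans x≤y y≤z

≤⇒≼ : {x y : Vector ℕ n} → (∀ l → x l ≤ y l) → x ≼ y
≤⇒≼ x≤y π = π , cost-mono-≤ π x≤y

≗⇒≼ : {x y : Vector ℕ n} → x ≗ y → x ≼ y
≗⇒≼ x≗y = ≤⇒≼ (≤-reflexive ∘ x≗y)

≼-permute : (σ : Permutation′ n) (x : Vector ℕ n) → x ≼ x ∘ (σ ⟨$⟩ʳ_)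
≼-permute σ x π = relabel σ π , ≤-reflexive (cost-relabel σ π x)

weighted-transfer-≤ : ∀ {a a′ b b′ u v} → a′ ≤ a → a′ + b′ ≡ a + b → v ≤ u →
                      u * a′ + v * b′ ≤ u * a + v * b
weighted-transfer-≤ {a′ = a′} {b} {b′} {u} {v} a′≤a same-total v≤u
  with d , refl ← m≤n⇒∃[o]m+o≡n a′≤a = begin
    u * a′ + v * b′          ≡⟨ cong (λ t → u * a′ + v * t) b′≡d+b ⟩
    u * a′ + v * (d + b)     ≡⟨ expand u v a′ b d ⟩
    u * a′ + v * b + v * d   ≤⟨ +-monoʳ-≤ (u * a′ + v * b) (*-monoˡ-≤ d v≤u) ⟩
    u * a′ + v * b + u * d   ≡⟨ regroup u v a′ b d ⟩
    u * (a′ + d) + v * b     ∎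
  where
    open ≤-Reasoning
    b′≡d+b : b′ ≡ d + b
    b′≡d+b = +-cancelˡ-≡ a′ b′ (d + b) (trans same-total (+-assoc a′ d b))
    expand : ∀ u v a′ b d → u * a′ + v * (d + b) ≡ u * a′ + v * b + v * d
    expand = solve-∀
    regroup : ∀ u v a′ b d → u * a′ + v * b + u * d ≡ u * (a′ + d) + v * b
    regroup = solve-∀

cost-transfer : (π : Play n k) {x′ x : Vector ℕ n} {p q : Fin n} → p ≢ q →
                (∀ l → l ≢ p → l ≢ q → x′ l ≡ x l) → x′ p + x′ q ≡ x p + x q →
                x′ p ≤ x p → weight π q ≤ weight π p → cost π x′ ≤ cost π x
cost-transfer {n} π {x′} {x} {p} {q} p≢q agree same-total x′p≤xp wq≤wp =
  +-cancelʳ-≤ (c p * x p + c q * x q) (cost π x′) (cost π x) (begin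
    cost π x′ + (c p * x p + c q * x q)  ≡⟨ cong (_+ (c p * x p + c q * x q)) (cost≡weight· π x′) ⟩
    c · x′ + (c p * x p + c q * x q)     ≡⟨ ∑-agree-outside p≢q (λ l l≢p l≢q → cong (c l *_) (agree l l≢p l≢q)) ⟩
    c · x + (c p * x′ p + c q * x′ q)    ≤⟨ +-monoʳ-≤ (c · x) (weighted-transfer-≤ x′p≤xp same-total wq≤wp) ⟩
    c · x + (c p * x p + c q * x q)      ≡⟨ cong (_+ (c p * x p + c q * x q)) (cost≡weight· π x) ⟨
    cost π x + (c p * x p + c q * x q)   ∎)
  where
    open ≤-Reasoning
    c : Vector ℕ n
    c = weight π

transpose-matchˡ : (i j : Fin n) → PC.transpose i j i ≡ j
transpose-matchˡ i j with i ≟ i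
... | yes _   = refl
... | no i≢i = contradiction refl i≢i

transpose-matchʳ : (i j : Fin n) → PC.transpose i j j ≡ i
transpose-matchʳ i j with j ≟ i
... | yes j≡i = j≡i
... | no _ with j ≟ j
...   | yes _   = refl
...   | no j≢j = contradiction refl j≢j

transpose-other : {i j l : Fin n} → l ≢ i → l ≢ j → PC.transpose i j l ≡ l
transpose-other {i = i} {j} {l} l≢i l≢j with l ≟ i
... | yes l≡i = contradiction l≡i l≢i
... | no _ with l ≟ j
...   | yes l≡j = contradiction l≡j l≢j
...   | no _    = refl

-- Whichever of p, q carries the larger weight in a given play receives the smaller entry,
-- possibly after swapping p and q throughout the play.
≼-transfer : {x′ x : Vector ℕ n} {p q : Fin n} → p ≢ q →
             (∀ l → l ≢ p → l ≢ q → x′ l ≡ x l) → x′ p + x′ q ≡ x p + x q →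
             x′ p ≤ x p → x′ p ≤ x q → x′ ≼ x
≼-transfer {n} {x′} {x} {p} {q} p≢q agree same-total x′p≤xp x′p≤xq π
  with ≤-total (weight π q) (weight π p)
... | inj₁ wq≤wp = π , cost-transfer π p≢q agree same-total x′p≤xp wq≤wp
... | inj₂ wp≤wq = relabel σ π , (begin
    cost (relabel σ π) x′   ≡⟨ cost-relabel σ π x′ ⟩
    cost π swapped          ≤⟨ cost-transfer π (≢-sym p≢q) agree-swapped same-total-swapped swapped-q≤xq wp≤wq ⟩
    cost π x                ∎)
  where
    open ≤-Reasoning
    σ : Permutation′ n
    σ = Perm.transpose p q
    swapped : Vector ℕ n
    swapped = x′ ∘ PC.transpose p q
    agree-swapped : ∀ l → l ≢ q → l ≢ p → swapped l ≡ x l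
    agree-swapped l l≢q l≢p = trans (cong x′ (transpose-other l≢p l≢q)) (agree l l≢p l≢q)
    same-total-swapped : swapped q + swapped p ≡ x q + x p
    same-total-swapped = trans (cong₂ _+_ (cong x′ (transpose-matchʳ p q)) (cong x′ (transpose-matchˡ p q)))
                               (trans same-total (+-comm (x p) (x q)))
    swapped-q≤xq : swapped q ≤ x q
    swapped-q≤xq = subst (_≤ x q) (sym (cong x′ (transpose-matchʳ p q))) x′p≤xq

module _ (x : Vector ℕ n) {a b j q : Fin n} (a≢b : a ≢ b) (j≢a : j ≢ a) (j≢b : j ≢ b)
         (q≢a : q ≢ a) (q≢b : q ≢ b) (q≢j : q ≢ j) (xb≤xj : x b ≤ x j) (xa≤xq : x a ≤ x q) where

  private
    paired crossed mixed : Vector ℕ n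
    paired  = move′ (move′ x a b) j q
    crossed = move′ (move′ x a j) b q
    -- paired and crossed differ on four sheets, mixed differs from each of them on two:
    -- paired ≼ mixed and mixed ≼ crossed are single transfers.
    mixed   = updateAt (updateAt crossed a (λ _ → x a + x b)) q (λ _ → x j + x q)

    ab≤aj : x a + x b ≤ x a + x j
    ab≤aj = +-monoʳ-≤ (x a) xb≤xj
    ab≤bq : x a + x b ≤ x b + x q
    ab≤bq = subst (_≤ x b + x q) (+-comm (x b) (x a)) (+-monoʳ-≤ (x b) xa≤xq)

    paired-ab : ∀ {l} → l ≡ a ⊎ l ≡ b → paired l ≡ x a + x b
    paired-ab = move′²-first x j≢a j≢b q≢a q≢b
    paired-jq : ∀ {l} → l ≡ j ⊎ l ≡ q → paired l ≡ x j + x q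
    paired-jq = move′²-second x j≢a j≢b q≢a q≢b
    crossed-aj : ∀ {l} → l ≡ a ⊎ l ≡ j → crossed l ≡ x a + x j
    crossed-aj = move′²-first x (≢-sym a≢b) (≢-sym j≢b) q≢a q≢j
    crossed-bq : ∀ {l} → l ≡ b ⊎ l ≡ q → crossed l ≡ x b + x q
    crossed-bq = move′²-second x (≢-sym a≢b) (≢-sym j≢b) q≢a q≢j

    mixed-outside : ∀ l → l ≢ a → l ≢ q → mixed l ≡ crossed l
    mixed-outside l l≢a l≢q = trans (updateAt-minimal l q _ l≢q) (updateAt-minimal l a crossed l≢a)
    mixed-a : mixed a ≡ x a + x b
    mixed-a = trans (updateAt-minimal a q _ (≢-sym q≢a)) (updateAt-updates a crossed)
    mixed-q : mixed q ≡ x j + x q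
    mixed-q = updateAt-updates q _

    mixed≼crossed : mixed ≼ crossed
    mixed≼crossed = ≼-transfer (≢-sym q≢a) mixed-outside total
      (subst₂ _≤_ (sym mixed-a) (sym (crossed-aj (inj₁ refl))) ab≤aj)
      (subst₂ _≤_ (sym mixed-a) (sym (crossed-bq (inj₂ refl))) ab≤bq)
      where
        interchange : ∀ u v w z → (u + v) + (w + z) ≡ (u + w) + (v + z)
        interchange = solve-∀
        total : mixed a + mixed q ≡ crossed a + crossed q
        total = trans (cong₂ _+_ mixed-a mixed-q)
                      (trans (interchange (x a) (x b) (x j) (x q))
                             (sym (cong₂ _+_ (crossed-aj (inj₁ refl)) (crossed-bq (inj₂ refl)))))

    paired≼mixed : paired ≼ mixed
    paired≼mixed = ≼-transfer (≢-sym j≢b) outside total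
      (subst₂ _≤_ (sym (paired-ab (inj₂ refl))) (sym mixed-b) ab≤bq)
      (subst₂ _≤_ (sym (paired-ab (inj₂ refl))) (sym mixed-j) ab≤aj)
      where
        mixed-b : mixed b ≡ x b + x q
        mixed-b = trans (mixed-outside b (≢-sym a≢b) (≢-sym q≢b)) (crossed-bq (inj₁ refl))
        mixed-j : mixed j ≡ x a + x j
        mixed-j = trans (mixed-outside j j≢a (≢-sym q≢j)) (crossed-aj (inj₂ refl))
        outside : ∀ l → l ≢ b → l ≢ j → paired l ≡ mixed l
        outside l l≢b l≢j with locate a q l
        ... | inj₁ (inj₁ refl) = trans (paired-ab (inj₁ refl)) (sym mixed-a)
        ... | inj₁ (inj₂ refl) = trans (paired-jq (inj₂ refl)) (sym mixed-q)
        ... | inj₂ (l≢a , l≢q) =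
          trans (move′²-outside x j≢a j≢b q≢a q≢b l≢a l≢b l≢j l≢q)
                (sym (trans (mixed-outside l l≢a l≢q)
                            (move′²-outside x (≢-sym a≢b) (≢-sym j≢b) q≢a q≢j l≢a l≢j l≢b l≢q)))
        interchange : ∀ u v w z → (u + v) + (w + z) ≡ (v + z) + (u + w)
        interchange = solve-∀
        total : paired b + paired j ≡ mixed b + mixed j
        total = trans (cong₂ _+_ (paired-ab (inj₂ refl)) (paired-jq (inj₁ refl)))
                      (trans (interchange (x a) (x b) (x j) (x q)) (sym (cong₂ _+_ mixed-b mixed-j)))

  move′-regroup-≼ : move′ (move′ x a b) j q ≼ move′ (move′ x a j) b q
  move′-regroup-≼ = ≼-trans paired≼mixed mixed≼crossed

lookup-move-≡ : (v : Config n) {i j l : Fin n} → l ≡ i ⊎ l ≡ j →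
                lookup (move v i j) l ≡ lookup v i + lookup v j
lookup-move-≡ v {i} {j} {l} (inj₂ refl) = lookup∘update l (v [ i ]≔ _) _
lookup-move-≡ v {i} {j} {l} (inj₁ refl) with l ≟ j
... | yes refl = lookup∘update l (v [ l ]≔ _) _
... | no l≢j   = trans (lookup∘update′ l≢j (v [ l ]≔ _) _) (lookup∘update l v _)

lookup-move-≢ : (v : Config n) {i j l : Fin n} → l ≢ i → l ≢ j → lookup (move v i j) l ≡ lookup v l
lookup-move-≢ v {i} l≢i l≢j = trans (lookup∘update′ l≢j (v [ i ]≔ _) _) (lookup∘update′ l≢i v _)

lookup-move : (v : Config n) (i j : Fin n) → lookup (move v i j) ≗ move′ (lookup v) i j
lookup-move v i j l with locate i j l
... | inj₁ l∈ij        = trans (lookup-move-≡ v l∈ij) (sym (move′-≡ (lookup v) l∈ij))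
... | inj₂ (l≢i , l≢j) = trans (lookup-move-≢ v l≢i l≢j) (sym (move′-≢ (lookup v) l≢i l≢j))

lookup-move² : (v : Config n) (a b i j : Fin n) →
               lookup (move (move v a b) i j) ≗ move′ (move′ (lookup v) a b) i j
lookup-move² v a b i j l = trans (lookup-move (move v a b) i j l) (move′-cong i j (lookup-move v a b) l)

sum≡∑lookup : (v : Config n) → sum v ≡ ∑ (lookup v)
sum≡∑lookup []      = refl
sum≡∑lookup (x ∷ v) = cong (x +_) (sum≡∑lookup v)

sum-move : (v : Config n) {i j : Fin n} → i ≢ j → sum (move v i j) ≡ sum v + (lookup v i + lookup v j)
sum-move v {i} {j} i≢j = begin
  sum (move v i j)                        ≡⟨ sum≡∑lookup (move v i j) ⟩
  ∑ (lookup (move v i j))                 ≡⟨ sum-cong-≗ (lookup-move v i j) ⟩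
  ∑ (move′ (lookup v) i j)                ≡⟨ ∑-move′ (lookup v) i≢j ⟩
  ∑ (lookup v) + (lookup v i + lookup v j) ≡⟨ cong (_+ (lookup v i + lookup v j)) (sum≡∑lookup v) ⟨
  sum v + (lookup v i + lookup v j)       ∎
  where open ≡-Reasoning

move-sym : (v : Config n) (i j : Fin n) → move v i j ≡ move v j i
move-sym v i j = begin
  move v i j                        ≡⟨ tabulate∘lookup (move v i j) ⟨
  tabulate (lookup (move v i j))    ≡⟨ tabulate-cong (λ l → trans (lookup-move v i j l)
                                         (trans (move′-sym (lookup v) i j l) (sym (lookup-move v j i l)))) ⟩
  tabulate (lookup (move v j i))    ≡⟨ tabulate∘lookup (move v j i) ⟩
  move v j i                        ∎
  where open ≡-Reasoning

Reachable-move-sym : {v w : Config n} {i j : Fin n} →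
                     Reachable k (move v i j) w → Reachable k (move v j i) w
Reachable-move-sym {v = v} {w} {i} {j} = subst (λ v′ → Reachable _ v′ w) (move-sym v i j)

Achievable : ℕ → Config n → ℕ → Set
Achievable {n} k v s = ∃ λ (w : Config n) → Reachable k v w × sum w ≤ s

Achievable-move-sym : {v : Config n} {i j : Fin n} {s : ℕ} →
                      Achievable k (move v i j) s → Achievable k (move v j i) s
Achievable-move-sym (w , r , w≤s) = w , Reachable-move-sym r , w≤s

Reachable⇒Play : {v w : Config n} → Reachable k v w → Σ (Play n k) λ π → sum w ≡ cost π (lookup v)
Reachable⇒Play {v = v} done = [] , sum≡∑lookup v
Reachable⇒Play {v = v} (step i j i≢j r) with π , sum≡cost ← Reachable⇒Play r =
  step i j i≢j π , trans sum≡cost (cost-cong π (lookup-move v i j))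

Play⇒Reachable : (π : Play n k) (v : Config n) → ∃ λ w → Reachable k v w × sum w ≡ cost π (lookup v)
Play⇒Reachable []               v = v , done , sum≡∑lookup v
Play⇒Reachable (step i j i≢j π) v with w , r , sum≡cost ← Play⇒Reachable π (move v i j) =
  w , step i j i≢j r , trans sum≡cost (cost-cong π (lookup-move v i j))

≼⇒Achievable : {v v′ w′ : Config n} → lookup v ≼ lookup v′ → Reachable k v′ w′ → Achievable k v (sum w′)
≼⇒Achievable {v = v} v≼v′ r′ with π , sum≡cost ← Reachable⇒Play r′ with π′ , cost≤ ← v≼v′ π
  with w , r , sum≡cost′ ← Play⇒Reachable π′ v =
  w , r , subst₂ _≤_ (sym sum≡cost′) (sym sum≡cost) cost≤

-- The greedy strategy

argmin : (x : Vector ℕ (suc n)) → ∃ λ a → ∀ l → x a ≤ x l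
argmin {zero}  x = zero , λ { zero → ≤-refl }
argmin {suc n} x with a , a-min ← argmin (x ∘ suc) with x zero ≤? x (suc a)
... | yes x0≤xa = zero , λ { zero → ≤-refl ; (suc l) → ≤-trans x0≤xa (a-min l) }
... | no x0≰xa  = suc a , λ { zero → <⇒≤ (≰⇒> x0≰xa) ; (suc l) → a-min l }

argmin-except : (x : Vector ℕ (suc (suc n))) (o : Fin (suc (suc n))) →
                ∃ λ q → q ≢ o × (∀ l → l ≢ o → x q ≤ x l)
argmin-except x o with q , q-min ← argmin (x ∘ punchIn o) =
  punchIn o q , punchInᵢ≢i o q ,
  λ l l≢o → subst (x (punchIn o q) ≤_) (cong x (punchIn-punchOut (≢-sym l≢o))) (q-min _)

twoSmallest : (v : Config (suc (suc n))) → ∃ λ a → ∃ λ b → TwoSmallest v a b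
twoSmallest v with a , a-min ← argmin (lookup v) with b , b≢a , b-min ← argmin-except (lookup v) a =
  a , b , ≢-sym b≢a , λ l l≢a _ → a-min l , b-min l l≢a

greedyPlay : ∀ k (v : Config (suc (suc n))) → ∃ λ w → GreedyPlay k v w
greedyPlay zero    v = v , done
greedyPlay (suc k) v with a , b , smallest ← twoSmallest v with w , g ← greedyPlay k (move v a b) =
  w , step a b smallest g

GreedyPlay⇒Reachable : {v w : Config n} → GreedyPlay k v w → Reachable k v w
GreedyPlay⇒Reachable done                    = done
GreedyPlay⇒Reachable (step i j (i≢j , _) g) = step i j i≢j (GreedyPlay⇒Reachable g)

TwoSmallest-minˡ : (v : Config n) {a b : Fin n} → TwoSmallest v a b → ∀ l → l ≢ b → lookup v a ≤ lookup v l
TwoSmallest-minˡ v {a} (_ , small) l l≢b with l ≟ a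
... | yes refl = ≤-refl
... | no l≢a   = proj₁ (small l l≢a l≢b)

TwoSmallest-minʳ : (v : Config n) {a b : Fin n} → TwoSmallest v a b → ∀ l → l ≢ a → lookup v b ≤ lookup v l
TwoSmallest-minʳ v {b = b} (_ , small) l l≢a with l ≟ b
... | yes refl = ≤-refl
... | no l≢b   = proj₂ (small l l≢a l≢b)

TwoSmallest-sym : (v : Config n) {a b : Fin n} → TwoSmallest v a b → TwoSmallest v b a
TwoSmallest-sym v (a≢b , small) = ≢-sym a≢b , λ l l≢b l≢a → swap× (small l l≢a l≢b)

TwoSmallest-minimal-move : (v : Config n) {a b i j : Fin n} → TwoSmallest v a b → i ≢ j →
                           lookup v a + lookup v b ≤ lookup v i + lookup v j
TwoSmallest-minimal-move v {a} {b} {i} {j} smallest i≢j with i ≟ a | j ≟ b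
... | yes refl | _        = +-monoʳ-≤ (lookup v a) (TwoSmallest-minʳ v smallest j (≢-sym i≢j))
... | no _     | yes refl = +-monoˡ-≤ (lookup v b) (TwoSmallest-minˡ v smallest i i≢j)
... | no i≢a   | no j≢b   = subst (lookup v a + lookup v b ≤_) (+-comm (lookup v j) (lookup v i))
                              (+-mono-≤ (TwoSmallest-minˡ v smallest j j≢b) (TwoSmallest-minʳ v smallest i i≢a))

TwoSmallest-fromMinima : (v : Config n) {g : Vector ℕ n} {c d : Fin n} → lookup v ≗ g → c ≢ d →
                       (∀ l → l ≢ c → g c ≤ g l) → (∀ l → l ≢ c → g d ≤ g l) → TwoSmallest v c d
TwoSmallest-fromMinima v v≗g c≢d c-min d-min =
  c≢d , λ l l≢c _ → subst₂ _≤_ (sym (v≗g _)) (sym (v≗g l)) (c-min l l≢c) ,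
                    subst₂ _≤_ (sym (v≗g _)) (sym (v≗g l)) (d-min l l≢c)

module _ {m : ℕ} where

  GreedyOptimal : ℕ → Set
  GreedyOptimal k = ∀ {v wG wH : Config (2 + m)} → GreedyPlay k v wG → Reachable k v wH → sum wG ≤ sum wH

  -- By induction the play after (i, j) may be taken greedy, starting with (c, d); it then
  -- suffices that a second move (i′, j′) after (a, b) leads to a dominating vector.
  exchange : ∀ {k} {u wH : Config (2 + m)} {a b i j c d i′ j′} → GreedyOptimal (suc k) →
             TwoSmallest (move u i j) c d → i′ ≢ j′ →
             move′ (move′ (lookup u) a b) i′ j′ ≼ move′ (move′ (lookup u) i j) c d →
             Reachable (suc k) (move u i j) wH → Achievable (suc k) (move u a b) (sum wH)
  exchange {k} {u} {a = a} {b} {i} {j} {c} {d} {i′} {j′} optimal smallest i′≢j′ better H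
    with _ , G ← greedyPlay k (move (move u i j) c d)
    with w , R , w≤wG ← ≼⇒Achievable (≼-trans (≗⇒≼ (lookup-move² u a b i′ j′))
                                       (≼-trans better (≗⇒≼ (sym ∘ lookup-move² u i j c d))))
                                      (GreedyPlay⇒Reachable G) =
    w , step i′ j′ i′≢j′ R , ≤-trans w≤wG (optimal (step c d smallest G) H)

  greedy-first-move-disjoint : ∀ {k} {u wH : Config (2 + m)} {a b i j} → GreedyOptimal (suc k) →
                               TwoSmallest u a b → i ≢ j → i ≢ a → i ≢ b → j ≢ a → j ≢ b →
                               Reachable (suc k) (move u i j) wH → Achievable (suc k) (move u a b) (sum wH)
  greedy-first-move-disjoint {u = u} {a = a} {b} {i} {j} optimal (a≢b , small) i≢j i≢a i≢b j≢a j≢b =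
    exchange optimal (a≢b , still-smallest) i≢j (≗⇒≼ (move′-comm (lookup u) i≢a i≢b j≢a j≢b))
    where
      grows : ∀ l → lookup u l ≤ lookup (move u i j) l
      grows l = subst (lookup u l ≤_) (sym (lookup-move u i j l)) (move′-inflationary (lookup u) i j l)
      still-smallest : ∀ l → l ≢ a → l ≢ b →
                       lookup (move u i j) a ≤ lookup (move u i j) l ×
                       lookup (move u i j) b ≤ lookup (move u i j) l
      still-smallest l l≢a l≢b =
        subst (_≤ _) (sym (lookup-move-≢ u (≢-sym i≢a) (≢-sym j≢a)))
              (≤-trans (proj₁ (small l l≢a l≢b)) (grows l)) ,
        subst (_≤ _) (sym (lookup-move-≢ u (≢-sym i≢b) (≢-sym j≢b)))
              (≤-trans (proj₂ (small l l≢a l≢b)) (grows l))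

  greedy-first-move-shared : ∀ {k} {u wH : Config (2 + m)} {a b j} → GreedyOptimal (suc k) →
                             TwoSmallest u a b → j ≢ a → j ≢ b →
                             Reachable (suc k) (move u a j) wH → Achievable (suc k) (move u a b) (sum wH)
  greedy-first-move-shared {k} {u} {wH} {a} {b} {j} optimal smallest@(a≢b , _) j≢a j≢b H =
    next-smallest (argmin-except y b)
    where
      x y : Vector ℕ (2 + m)
      x = lookup u
      y = move′ x a j
      xb≤xj : x b ≤ x j
      xb≤xj = TwoSmallest-minʳ u smallest j j≢a
      b-min : ∀ l → l ≢ b → y b ≤ y l
      b-min l l≢b with locate a j l
      ... | inj₁ l∈aj = subst₂ _≤_ (sym (move′-≢ x (≢-sym a≢b) (≢-sym j≢b))) (sym (move′-≡ x l∈aj))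
                          (≤-trans xb≤xj (m≤n+m (x j) (x a)))
      ... | inj₂ (l≢a , l≢j) = subst₂ _≤_ (sym (move′-≢ x (≢-sym a≢b) (≢-sym j≢b))) (sym (move′-≢ x l≢a l≢j))
                                 (TwoSmallest-minʳ u smallest l l≢a)
      next-smallest : (∃ λ q → q ≢ b × (∀ l → l ≢ b → y q ≤ y l)) → Achievable (suc k) (move u a b) (sum wH)
      next-smallest (q , q≢b , q-min) with locate a j q
      ... | inj₁ q∈aj =
        exchange optimal (TwoSmallest-fromMinima (move u a j) (lookup-move u a j) (≢-sym j≢b) b-min j-min) j≢b
                 (≤⇒≼ (move′-reorder-≤ x a≢b j≢a j≢b xb≤xj)) H
        where
          j-min : ∀ l → l ≢ b → y j ≤ y l
          j-min l l≢b = subst (_≤ y l) (trans (move′-≡ x q∈aj) (sym (move′-≡ x (inj₂ refl)))) (q-min l l≢b)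
      ... | inj₂ (q≢a , q≢j) =
        exchange optimal (TwoSmallest-fromMinima (move u a j) (lookup-move u a j) (≢-sym q≢b) b-min q-min)
                 (≢-sym q≢j)
                 (move′-regroup-≼ x a≢b j≢a j≢b q≢a q≢b q≢j xb≤xj (TwoSmallest-minˡ u smallest q q≢b)) H

  greedy-first-move : ∀ {k} {u wH : Config (2 + m)} {a b i j} → GreedyOptimal k →
                      TwoSmallest u a b → i ≢ j →
                      Reachable k (move u i j) wH → Achievable k (move u a b) (sum wH)
  greedy-first-move {zero} {u} {a = a} {b} {i} {j} _ smallest i≢j done =
    move u a b , done , subst₂ _≤_ (sym (sum-move u (proj₁ smallest))) (sym (sum-move u i≢j))
                          (+-monoʳ-≤ (sum u) (TwoSmallest-minimal-move u smallest i≢j))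
  greedy-first-move {suc k} {u} {wH} {a} {b} {i} {j} optimal smallest i≢j H with i ≟ a | i ≟ b | j ≟ a | j ≟ b
  ... | yes refl | _        | _        | yes refl = wH , H , ≤-refl
  ... | yes refl | _        | yes refl | _        = contradiction refl i≢j
  ... | yes refl | _        | no j≢a   | no j≢b   = greedy-first-move-shared optimal smallest j≢a j≢b H
  ... | no _     | yes refl | yes refl | _        = wH , Reachable-move-sym H , ≤-refl
  ... | no _     | yes refl | no _     | yes refl = contradiction refl i≢j
  ... | no _     | yes refl | no j≢a   | no j≢b   =
    Achievable-move-sym (greedy-first-move-shared optimal (TwoSmallest-sym u smallest) j≢b j≢a H)
  ... | no i≢a   | no i≢b   | yes refl | _        =
    greedy-first-move-shared optimal smallest i≢a i≢b (Reachable-move-sym H)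
  ... | no i≢a   | no i≢b   | no _     | yes refl =
    Achievable-move-sym
      (greedy-first-move-shared optimal (TwoSmallest-sym u smallest) i≢b i≢a (Reachable-move-sym H))
  ... | no i≢a   | no i≢b   | no j≢a   | no j≢b   =
    greedy-first-move-disjoint optimal smallest i≢j i≢a i≢b j≢a j≢b H

  greedy-optimal : ∀ k → GreedyOptimal k
  greedy-optimal zero    done done = ≤-refl
  greedy-optimal (suc k) (step a b smallest G) (step i j i≢j H)
    with w , R , w≤wH ← greedy-first-move (greedy-optimal k) smallest i≢j H = ≤-trans (greedy-optimal k G R) w≤wH

theorem4 : ∀ (n : ℕ) → 2 ≤ n → (S : Config n) → Positive S → (k : ℕ) →
           (w : Config n) → GreedyPlay k S w → IsOpt S k (sum w)
theorem4 (suc (suc _)) (s≤s (s≤s z≤n)) _ _ k w G =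
  (w , GreedyPlay⇒Reachable G , refl) , λ _ → greedy-optimal k G
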